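{- Let $f:\mathbb{Z}_{\ge0}\to\mathbb{Z}_{\ge0}$ be nondecreasing with $G_f(\{y,z\})=y\oplus z$ for all $y,z\in\mathbb{Z}_{\ge0}$ with $y\le f(z)$. Then for all $y,z\in\mathbb{Z}_{\ge0}$ with $y\le f(z)$, $\{G_f(\{\min(y,f(w)),w\}):w<z\}=\{y\oplus w:w<z\}$ (with $w$ ranging over $\mathbb{Z}_{\ge0}$).
   Context: $\oplus$ denotes nim-sum (bitwise XOR). Positions of the chocolate bar game $CB(f,y,z)$ are pairs $\{y,z\}$ with $y\le f(z)$ (bar with $z+1$ columns, column 0 bitter, column $i$ of height $\min(f(i),y)+1$). Moves: $move_f(\{y,z\})=\{\{v,z\}:v<y\}\cup\{\{\min(y,f(w)),w\}:w<z\}$. Grundy number: $G_f(\{y,z\})=\mathrm{mex}\{G_f(p):p\in move_f(\{y,z\})\}$, mex being the least nonnegative integer not in the set. -}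

module Defs where

open import Data.Nat using (ℕ; zero; suc; _+_; _*_; _≤_; _<_; _⊓_)
open import Data.Nat.DivMod using (_/_; _%_)
open import Data.Nat.Properties using (_≟_)
open import Data.List using (List; []; _∷_; _++_; [_]; map; zip; upTo; length)
open import Data.List.Membership.DecPropositional _≟_ using (_∈?_)
open import Data.Product using (_,_; _×_)
open import Relation.Nullary using (yes; no)

-- Nim-sum (bitwise XOR) on ℕ, computed bit by bit; the fuel argument
-- bounds the number of bits processed (m + n bits always suffice).
xorFuel : ℕ → ℕ → ℕ → ℕ
xorFuel zero    m n = 0
xorFuel (suc k) m n = ((m % 2) + (n % 2)) % 2 + 2 * xorFuel k (m / 2) (n / 2)

infixl 6 _⊕_
_⊕_ : ℕ → ℕ → ℕ
m ⊕ n = xorFuel (m + n) m n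

-- mex of a finite list: least natural number not occurring in it.
-- Searching from n with fuel (length l + 1) is enough to find it.
mexFrom : ℕ → ℕ → List ℕ → ℕ
mexFrom zero    n l = n
mexFrom (suc k) n l with n ∈? l
... | yes _ = mexFrom k (suc n) l
... | no  _ = n

mex : List ℕ → ℕ
mex l = mexFrom (suc (length l)) 0 l

-- Grundy numbers of CB(f,y,z), column by column.
-- prev = [G_f({-,0}), ..., G_f({-,z-1})] (as functions of the first coordinate).
-- Options of {y,z} reached by moving to a column w < z:
optsW : (ℕ → ℕ) → ℕ → List (ℕ → ℕ) → ℕ → List ℕ
optsW f z prev y = map (λ p → Data.Product.proj₂ p (y ⊓ f (Data.Product.proj₁ p))) (zip (upTo z) prev)

-- colVals f z prev y = [G_f({0,z}), ..., G_f({y-1,z})]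
colVals : (ℕ → ℕ) → ℕ → List (ℕ → ℕ) → ℕ → List ℕ
colVals f z prev zero    = []
colVals f z prev (suc y) =
  colVals f z prev y ++ [ mex (colVals f z prev y ++ optsW f z prev y) ]

column : (ℕ → ℕ) → ℕ → List (ℕ → ℕ) → ℕ → ℕ
column f z prev y = mex (colVals f z prev y ++ optsW f z prev y)

columns : (ℕ → ℕ) → ℕ → List (ℕ → ℕ)
columns f zero    = []
columns f (suc z) = columns f z ++ [ column f z (columns f z) ]

-- Grundy number G_f({y,z}) (meaningful for y ≤ f z).
G : (ℕ → ℕ) → ℕ → ℕ → ℕ
G f y z = column f z (columns f z) y

Nondecreasing : (ℕ → ℕ) → Set
Nondecreasing f = ∀ {m n} → m ≤ n → f m ≤ f n

-- If y ≤ f z, the new column z contributes G({y,z}) = y ⊕ z to both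
-- sides. Otherwise every move to a column w ≤ z lands at height f w, so the left-hand
-- side is the same for all heights s ≥ f z, and it remains to see that s ⊕ [0,z] does
-- not change when s grows to s+1 ≤ f(z+1). Since G({s+1,z+1}) = (s+1) ⊕ (z+1) is a mex,
-- every smaller number is v ⊕ (z+1) with v ≤ s or lies in s ⊕ [0,z], while (s+1) ⊕ (z+1)
-- itself does not; halving s and z+1 simultaneously shows that this forces [0,z] to be
-- closed under ⊕ (s ⊕ (s+1)), which maps s ⊕ [0,z] onto (s+1) ⊕ [0,z].

module Submission where

open import Defs
open import Data.Nat
open import Data.Nat.Properties
open import Data.Nat.DivMod
open import Data.Nat.Induction using (<-wellFounded)
open import Induction.WellFounded using (Acc; acc)
open import Data.Empty using (⊥; ⊥-elim)
open import Data.Product using (Σ; _×_; _,_)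
open import Data.Sum using (_⊎_; inj₁; inj₂; map₂)
open import Data.Sum.Function.Propositional using (_⊎-⇔_)
open import Data.List using (List; []; _∷_; _++_; [_]; map; zip; upTo; length)
open import Data.List.Properties using (length-++; map-++; upTo-∷ʳ; length-upTo)
open import Data.List.Relation.Unary.Any using (here; there)
open import Data.List.Membership.Propositional using (_∈_; _∉_)
open import Data.List.Membership.Propositional.Properties using (∈-++⁺ˡ; ∈-++⁺ʳ; ∈-++⁻; ∈-∃++)
open import Data.List.Membership.DecPropositional _≟_ using (_∈?_)
open import Function.Bundles using (_⇔_; mk⇔; Equivalence)
open import Function.Properties.Equivalence using (⇔-setoid)
open import Level using (0ℓ)
open import Relation.Binary.PropositionalEquality hiding ([_])
open import Relation.Nullary using (¬_; yes; no; contradiction)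

half-≤ : ∀ {a k} → a ≤ suc k → a / 2 ≤ k
half-≤ {a} {k} a≤ = ≤-pred (≤-<-trans (/-monoˡ-≤ 2 a≤) (m/n<m (suc k) 2 (s≤s (s≤s z≤n))))

m%2+2*[m/2]≡m : ∀ m → m % 2 + 2 * (m / 2) ≡ m
m%2+2*[m/2]≡m m = trans (cong (m % 2 +_) (*-comm 2 (m / 2))) (sym (m≡m%n+[m/n]*n m 2))

[i+2*n]%2≡i : ∀ {i} n → i < 2 → (i + 2 * n) % 2 ≡ i
[i+2*n]%2≡i {i} n i<2 = begin
  (i + 2 * n) % 2 ≡⟨ cong (λ t → (i + t) % 2) (*-comm 2 n) ⟩
  (i + n * 2) % 2 ≡⟨ [m+kn]%n≡m%n i n 2 ⟩
  i % 2           ≡⟨ m<n⇒m%n≡m i<2 ⟩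
  i               ∎
  where open ≡-Reasoning

[i+2*n]/2≡n : ∀ {i} n → i < 2 → (i + 2 * n) / 2 ≡ n
[i+2*n]/2≡n {i} n i<2 = *-cancelˡ-≡ _ n 2 (+-cancelˡ-≡ i _ _ (begin
  i + 2 * ((i + 2 * n) / 2)               ≡⟨ cong (_+ 2 * ((i + 2 * n) / 2)) ([i+2*n]%2≡i n i<2) ⟨
  (i + 2 * n) % 2 + 2 * ((i + 2 * n) / 2) ≡⟨ m%2+2*[m/2]≡m (i + 2 * n) ⟩
  i + 2 * n                               ∎))
  where open ≡-Reasoning

xorFuel-0-0 : ∀ k → xorFuel k 0 0 ≡ 0
xorFuel-0-0 zero    = refl
xorFuel-0-0 (suc k) = cong (2 *_) (xorFuel-0-0 k)

xorFuel-stable : ∀ {k k′ a b} → a ≤ k → b ≤ k → a ≤ k′ → b ≤ k′ → xorFuel k a b ≡ xorFuel k′ a b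
xorFuel-stable {zero}  {k′}     z≤n z≤n _   _   = sym (xorFuel-0-0 k′)
xorFuel-stable {suc k} {zero}   _   _   z≤n z≤n = xorFuel-0-0 (suc k)
xorFuel-stable {suc k} {suc k′} {a} {b} a≤k b≤k a≤k′ b≤k′ =
  cong (λ t → (a % 2 + b % 2) % 2 + 2 * t)
       (xorFuel-stable (half-≤ a≤k) (half-≤ b≤k) (half-≤ a≤k′) (half-≤ b≤k′))

⊕-unfold : ∀ a b → a ⊕ b ≡ (a % 2 + b % 2) % 2 + 2 * (a / 2 ⊕ b / 2)
⊕-unfold a b = begin
  xorFuel (a + b) a b                                          ≡⟨ xorFuel-stable a≤ b≤ (m≤n⇒m≤1+n a≤) (m≤n⇒m≤1+n b≤) ⟩
  (a % 2 + b % 2) % 2 + 2 * xorFuel (a + b) (a / 2) (b / 2)   ≡⟨ cong (λ t → (a % 2 + b % 2) % 2 + 2 * t)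
                                                                    (xorFuel-stable (≤-trans (m/n≤m a 2) a≤) (≤-trans (m/n≤m b 2) b≤)
                                                                                    (m≤m+n (a / 2) (b / 2)) (m≤n+m (b / 2) (a / 2))) ⟩
  (a % 2 + b % 2) % 2 + 2 * (a / 2 ⊕ b / 2)                   ∎
  where
  open ≡-Reasoning
  a≤ : a ≤ a + b
  a≤ = m≤m+n a b
  b≤ : b ≤ a + b
  b≤ = m≤n+m b a

⊕-%2 : ∀ a b → (a ⊕ b) % 2 ≡ (a + b) % 2
⊕-%2 a b = begin
  (a ⊕ b) % 2                                       ≡⟨ cong (_% 2) (⊕-unfold a b) ⟩
  ((a % 2 + b % 2) % 2 + 2 * (a / 2 ⊕ b / 2)) % 2   ≡⟨ [i+2*n]%2≡i (a / 2 ⊕ b / 2) (m%n<n (a % 2 + b % 2) 2) ⟩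
  (a % 2 + b % 2) % 2                               ≡⟨ %-distribˡ-+ a b 2 ⟨
  (a + b) % 2                                       ∎
  where open ≡-Reasoning

⊕-/2 : ∀ a b → (a ⊕ b) / 2 ≡ a / 2 ⊕ b / 2
⊕-/2 a b = trans (cong (_/ 2) (⊕-unfold a b)) ([i+2*n]/2≡n (a / 2 ⊕ b / 2) (m%n<n (a % 2 + b % 2) 2))

%2-/2-injective : ∀ {m n} → m % 2 ≡ n % 2 → m / 2 ≡ n / 2 → m ≡ n
%2-/2-injective {m} {n} m%2≡n%2 m/2≡n/2 = begin
  m                     ≡⟨ m%2+2*[m/2]≡m m ⟨
  m % 2 + 2 * (m / 2)   ≡⟨ cong₂ (λ r q → r + 2 * q) m%2≡n%2 m/2≡n/2 ⟩
  n % 2 + 2 * (n / 2)   ≡⟨ m%2+2*[m/2]≡m n ⟩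
  n                     ∎
  where open ≡-Reasoning

⊕-bits : ∀ {i j} a b → i < 2 → j < 2 → (i + 2 * a) ⊕ (j + 2 * b) ≡ (i + j) % 2 + 2 * (a ⊕ b)
⊕-bits {i} {j} a b i<2 j<2 = begin
  (i + 2 * a) ⊕ (j + 2 * b)                                      ≡⟨ ⊕-unfold (i + 2 * a) (j + 2 * b) ⟩
  ((i + 2 * a) % 2 + (j + 2 * b) % 2) % 2
    + 2 * ((i + 2 * a) / 2 ⊕ (j + 2 * b) / 2)                    ≡⟨ cong₂ (λ r q → r % 2 + 2 * q)
                                                                      (cong₂ _+_ ([i+2*n]%2≡i a i<2) ([i+2*n]%2≡i b j<2))
                                                                      (cong₂ _⊕_ ([i+2*n]/2≡n a i<2) ([i+2*n]/2≡n b j<2)) ⟩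
  (i + j) % 2 + 2 * (a ⊕ b)                                      ∎
  where open ≡-Reasoning

xorFuel-comm : ∀ k a b → xorFuel k a b ≡ xorFuel k b a
xorFuel-comm zero    a b = refl
xorFuel-comm (suc k) a b =
  cong₂ (λ r q → r % 2 + 2 * q) (+-comm (a % 2) (b % 2)) (xorFuel-comm k (a / 2) (b / 2))

⊕-comm : ∀ a b → a ⊕ b ≡ b ⊕ a
⊕-comm a b = trans (xorFuel-comm (a + b) a b) (cong (λ k → xorFuel k b a) (+-comm a b))

[n+n]%2≡0 : ∀ n → (n + n) % 2 ≡ 0
[n+n]%2≡0 n = trans (cong (λ t → (n + t) % 2) (sym (*-identityˡ n))) (trans (cong (_% 2) (*-comm 2 n)) (m*n%n≡0 n 2))

xorFuel-self : ∀ k a → xorFuel k a a ≡ 0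
xorFuel-self zero    a = refl
xorFuel-self (suc k) a = cong₂ (λ r q → r + 2 * q) ([n+n]%2≡0 (a % 2)) (xorFuel-self k (a / 2))

⊕-self : ∀ a → a ⊕ a ≡ 0
⊕-self a = xorFuel-self (a + a) a

xorFuel-identityʳ : ∀ {k a} → a ≤ k → xorFuel k a 0 ≡ a
xorFuel-identityʳ {zero}  z≤n = refl
xorFuel-identityʳ {suc k} {a} a≤ = begin
  (a % 2 + 0) % 2 + 2 * xorFuel k (a / 2) 0  ≡⟨ cong₂ (λ r q → r + 2 * q)
                                                  (trans (cong (_% 2) (+-identityʳ (a % 2))) (m%n%n≡m%n a 2))
                                                  (xorFuel-identityʳ (half-≤ a≤)) ⟩
  a % 2 + 2 * (a / 2)                        ≡⟨ m%2+2*[m/2]≡m a ⟩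
  a                                          ∎
  where open ≡-Reasoning

⊕-identityʳ : ∀ a → a ⊕ 0 ≡ a
⊕-identityʳ a = xorFuel-identityʳ (m≤m+n a 0)

⊕-identityˡ : ∀ a → 0 ⊕ a ≡ a
⊕-identityˡ a = trans (⊕-comm 0 a) (⊕-identityʳ a)

[a⊕b+c]%2≡[a+b+c]%2 : ∀ a b c → ((a ⊕ b) + c) % 2 ≡ ((a + b) + c) % 2
[a⊕b+c]%2≡[a+b+c]%2 a b c = begin
  ((a ⊕ b) + c) % 2              ≡⟨ %-distribˡ-+ (a ⊕ b) c 2 ⟩
  ((a ⊕ b) % 2 + c % 2) % 2      ≡⟨ cong (λ r → (r + c % 2) % 2) (⊕-%2 a b) ⟩
  ((a + b) % 2 + c % 2) % 2      ≡⟨ %-distribˡ-+ (a + b) c 2 ⟨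
  ((a + b) + c) % 2              ∎
  where open ≡-Reasoning

⊕-assoc-≤ : ∀ {k} a b c → a ≤ k → b ≤ k → c ≤ k → (a ⊕ b) ⊕ c ≡ a ⊕ (b ⊕ c)
⊕-assoc-≤ {zero}  0 0 0 _ _ _ = refl
⊕-assoc-≤ {suc k} a b c a≤ b≤ c≤ = %2-/2-injective same-parity same-half
  where
  open ≡-Reasoning
  same-parity : ((a ⊕ b) ⊕ c) % 2 ≡ (a ⊕ (b ⊕ c)) % 2
  same-parity = begin
    ((a ⊕ b) ⊕ c) % 2     ≡⟨ ⊕-%2 (a ⊕ b) c ⟩
    ((a ⊕ b) + c) % 2     ≡⟨ [a⊕b+c]%2≡[a+b+c]%2 a b c ⟩
    ((a + b) + c) % 2     ≡⟨ cong (_% 2) (+-assoc a b c) ⟩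
    (a + (b + c)) % 2     ≡⟨ cong (_% 2) (+-comm a (b + c)) ⟩
    ((b + c) + a) % 2     ≡⟨ [a⊕b+c]%2≡[a+b+c]%2 b c a ⟨
    ((b ⊕ c) + a) % 2     ≡⟨ cong (_% 2) (+-comm (b ⊕ c) a) ⟩
    (a + (b ⊕ c)) % 2     ≡⟨ ⊕-%2 a (b ⊕ c) ⟨
    (a ⊕ (b ⊕ c)) % 2     ∎
  same-half : ((a ⊕ b) ⊕ c) / 2 ≡ (a ⊕ (b ⊕ c)) / 2
  same-half = begin
    ((a ⊕ b) ⊕ c) / 2           ≡⟨ ⊕-/2 (a ⊕ b) c ⟩
    (a ⊕ b) / 2 ⊕ c / 2         ≡⟨ cong (_⊕ c / 2) (⊕-/2 a b) ⟩
    (a / 2 ⊕ b / 2) ⊕ c / 2     ≡⟨ ⊕-assoc-≤ (a / 2) (b / 2) (c / 2) (half-≤ a≤) (half-≤ b≤) (half-≤ c≤) ⟩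
    a / 2 ⊕ (b / 2 ⊕ c / 2)     ≡⟨ cong (a / 2 ⊕_) (⊕-/2 b c) ⟨
    a / 2 ⊕ (b ⊕ c) / 2         ≡⟨ ⊕-/2 a (b ⊕ c) ⟨
    (a ⊕ (b ⊕ c)) / 2           ∎

⊕-assoc : ∀ a b c → (a ⊕ b) ⊕ c ≡ a ⊕ (b ⊕ c)
⊕-assoc a b c = ⊕-assoc-≤ a b c (m≤m+n a (b + c)) (≤-trans (m≤m+n b c) (m≤n+m (b + c) a)) (≤-trans (m≤n+m c b) (m≤n+m (b + c) a))

⊕-cancelʳ : ∀ a b → (a ⊕ b) ⊕ b ≡ a
⊕-cancelʳ a b = trans (⊕-assoc a b b) (trans (cong (a ⊕_) (⊕-self b)) (⊕-identityʳ a))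

⊕-cancelˡ : ∀ a b → a ⊕ (a ⊕ b) ≡ b
⊕-cancelˡ a b = trans (sym (⊕-assoc a a b)) (trans (cong (_⊕ b) (⊕-self a)) (⊕-identityˡ b))

data ParityView : ℕ → Set where
  even : ∀ h → ParityView (2 * h)
  odd  : ∀ h → ParityView (suc (2 * h))

parityView : ∀ n → ParityView n
parityView zero = even 0
parityView (suc n) with parityView n
... | even h = odd h
... | odd h  = subst ParityView (*-suc 2 h) (even (suc h))

<2*⇒/2< : ∀ {x m} → x < 2 * m → x / 2 < m
<2*⇒/2< {x} {m} x< = m<n*o⇒m/o<n (subst (x <_) (*-comm 2 m) x<)

/2<⇒<2* : ∀ {x m} → x / 2 < m → x < 2 * m
/2<⇒<2* {x} {m} x/2<m = begin-strict
  x                        ≡⟨ m%2+2*[m/2]≡m x ⟨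
  x % 2 + 2 * (x / 2)      <⟨ +-monoˡ-< (2 * (x / 2)) (m%n<n x 2) ⟩
  2 + 2 * (x / 2)          ≡⟨ *-suc 2 (x / 2) ⟨
  2 * suc (x / 2)          ≤⟨ *-monoʳ-≤ 2 x/2<m ⟩
  2 * m                    ∎
  where open ≤-Reasoning

2*m≤1+2*k⇒m≤k : ∀ {m k} → 2 * m ≤ suc (2 * k) → m ≤ k
2*m≤1+2*k⇒m≤k {m} {k} le =
  subst₂ _≤_ ([i+2*n]/2≡n {0} m z<s) ([i+2*n]/2≡n {1} k (s≤s z<s)) (/-monoˡ-≤ 2 le)

-- s ⊕ (s+1) = 2^(t+1) − 1 where t is the number of trailing ones of s, so the claim is
-- that the hypotheses force 2^(t+1) ∣ n. For even s this means that n is even; for odd s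
-- they force n to be even and descend to ⌊s/2⌋ and n/2.
⊕-mask-closed-acc : ∀ {s} → Acc _<_ s → ∀ n →
  (∀ x → x < suc s ⊕ n → x ⊕ n ≤ s ⊎ x ⊕ s < n) →
  n ≤ (suc s ⊕ n) ⊕ s →
  ∀ w → w < n → w ⊕ (s ⊕ suc s) < n
⊕-mask-closed-acc {s} (acc rec) n covered top w w<n with parityView s | parityView n
... | even h | odd m = ⊥-elim (1+n≰n (subst (suc (2 * m) ≤_) top≡ top))
  where
  top≡ : (suc (2 * h) ⊕ suc (2 * m)) ⊕ 2 * h ≡ 2 * m
  top≡ = begin
    (suc (2 * h) ⊕ suc (2 * m)) ⊕ 2 * h   ≡⟨ cong (_⊕ 2 * h) (⊕-bits h m (s≤s z<s) (s≤s z<s)) ⟩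
    2 * (h ⊕ m) ⊕ 2 * h                   ≡⟨ ⊕-bits (h ⊕ m) h z<s z<s ⟩
    2 * ((h ⊕ m) ⊕ h)                     ≡⟨ cong (λ t → 2 * (t ⊕ h)) (⊕-comm h m) ⟩
    2 * ((m ⊕ h) ⊕ h)                     ≡⟨ cong (2 *_) (⊕-cancelʳ m h) ⟩
    2 * m                                 ∎
    where open ≡-Reasoning
... | even h | even m = /2<⇒<2* (subst (_< m) (sym half≡) (<2*⇒/2< w<n))
  where
  half≡ : (w ⊕ (2 * h ⊕ suc (2 * h))) / 2 ≡ w / 2
  half≡ = begin
    (w ⊕ (2 * h ⊕ suc (2 * h))) / 2   ≡⟨ cong (λ t → (w ⊕ t) / 2) (⊕-bits h h z<s (s≤s z<s)) ⟩
    (w ⊕ suc (2 * (h ⊕ h))) / 2       ≡⟨ cong (λ t → (w ⊕ suc (2 * t)) / 2) (⊕-self h) ⟩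
    (w ⊕ 1) / 2                       ≡⟨ ⊕-/2 w 1 ⟩
    w / 2 ⊕ 0                         ≡⟨ ⊕-identityʳ (w / 2) ⟩
    w / 2                             ∎
    where open ≡-Reasoning
... | odd h | odd m = ⊥-elim (refute (covered (2 * q) (subst (2 * q <_) (sym successor≡) ≤-refl)))
  where
  q : ℕ
  q = suc h ⊕ m
  successor≡ : suc (suc (2 * h)) ⊕ suc (2 * m) ≡ suc (2 * q)
  successor≡ = trans (cong (_⊕ suc (2 * m)) (sym (*-suc 2 h))) (⊕-bits (suc h) m z<s (s≤s z<s))
  refute : 2 * q ⊕ suc (2 * m) ≤ suc (2 * h) ⊎ 2 * q ⊕ suc (2 * h) < suc (2 * m) → ⊥
  refute (inj₁ le) = 1+n≰n (*-cancelˡ-≤ 2 (≤-pred (subst (_≤ suc (2 * h)) q⊕n≡ le)))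
    where
    q⊕n≡ : 2 * q ⊕ suc (2 * m) ≡ suc (2 * suc h)
    q⊕n≡ = trans (⊕-bits q m z<s (s≤s z<s)) (cong (λ t → suc (2 * t)) (⊕-cancelʳ (suc h) m))
  refute (inj₂ lt) = 1+n≰n (≤-trans (n≤1+n _) (≤-trans lt′ top′))
    where
    lt′ : suc (suc (2 * (q ⊕ h))) ≤ suc (2 * m)
    lt′ = subst (λ t → suc t ≤ suc (2 * m)) (⊕-bits q h z<s (s≤s z<s)) lt
    top′ : suc (2 * m) ≤ 2 * (q ⊕ h)
    top′ = subst (suc (2 * m) ≤_) (trans (cong (_⊕ suc (2 * h)) successor≡) (⊕-bits q h (s≤s z<s) (s≤s z<s))) top
... | odd h | even m = /2<⇒<2* (subst (_< m) (sym half≡) (below (w / 2) (<2*⇒/2< w<n)))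
  where
  Q : ℕ
  Q = suc h ⊕ m
  successor≡ : suc (suc (2 * h)) ⊕ 2 * m ≡ 2 * Q
  successor≡ = trans (cong (_⊕ 2 * m) (sym (*-suc 2 h))) (⊕-bits (suc h) m z<s z<s)
  covered′ : ∀ x → x < Q → x ⊕ m ≤ h ⊎ x ⊕ h < m
  covered′ x x<Q with covered (suc (2 * x)) (subst (suc (2 * x) <_) (sym successor≡)
                                 (/2<⇒<2* (subst (_< Q) (sym ([i+2*n]/2≡n x (s≤s z<s))) x<Q)))
  ... | inj₁ le = inj₁ (*-cancelˡ-≤ 2 (≤-pred (subst (_≤ suc (2 * h)) (⊕-bits x m (s≤s z<s) z<s) le)))
  ... | inj₂ lt = inj₂ (*-cancelˡ-< 2 _ _ (subst (_< 2 * m) (⊕-bits x h (s≤s z<s) (s≤s z<s)) lt))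
  top′ : m ≤ Q ⊕ h
  top′ = 2*m≤1+2*k⇒m≤k (subst (2 * m ≤_) (trans (cong (_⊕ suc (2 * h)) successor≡) (⊕-bits Q h z<s (s≤s z<s))) top)
  below : ∀ w → w < m → w ⊕ (h ⊕ suc h) < m
  below = ⊕-mask-closed-acc (rec (s≤s (m≤m+n h _))) m covered′ top′
  half≡ : (w ⊕ (suc (2 * h) ⊕ suc (suc (2 * h)))) / 2 ≡ w / 2 ⊕ (h ⊕ suc h)
  half≡ = begin
    (w ⊕ (suc (2 * h) ⊕ suc (suc (2 * h)))) / 2   ≡⟨ cong (λ t → (w ⊕ (suc (2 * h) ⊕ t)) / 2) (*-suc 2 h) ⟨
    (w ⊕ (suc (2 * h) ⊕ 2 * suc h)) / 2           ≡⟨ cong (λ t → (w ⊕ t) / 2) (⊕-bits h (suc h) (s≤s z<s) z<s) ⟩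
    (w ⊕ suc (2 * (h ⊕ suc h))) / 2               ≡⟨ ⊕-/2 w _ ⟩
    w / 2 ⊕ suc (2 * (h ⊕ suc h)) / 2             ≡⟨ cong (w / 2 ⊕_) ([i+2*n]/2≡n (h ⊕ suc h) (s≤s z<s)) ⟩
    w / 2 ⊕ (h ⊕ suc h)                           ∎
    where open ≡-Reasoning

⊕-mask-closed : ∀ s n →
  (∀ x → x < suc s ⊕ n → x ⊕ n ≤ s ⊎ x ⊕ s < n) →
  n ≤ (suc s ⊕ n) ⊕ s →
  ∀ w → w < n → w ⊕ (s ⊕ suc s) < n
⊕-mask-closed s = ⊕-mask-closed-acc (<-wellFounded s)

XorImage : ℕ → ℕ → ℕ → Set
XorImage s n x = Σ ℕ λ w → w < n × s ⊕ w ≡ x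

xorImage⇔ : ∀ {s n x} → XorImage s n x ⇔ x ⊕ s < n
xorImage⇔ {s} {n} {x} = mk⇔ to from
  where
  to : XorImage s n x → x ⊕ s < n
  to (w , w<n , refl) = subst (_< n) (sym (trans (cong (_⊕ s) (⊕-comm s w)) (⊕-cancelʳ w s))) w<n
  from : x ⊕ s < n → XorImage s n x
  from x⊕s<n = x ⊕ s , x⊕s<n , trans (cong (s ⊕_) (⊕-comm x s)) (⊕-cancelˡ s x)

xorImage-shift : ∀ {s d n x} → (∀ w → w < n → w ⊕ d < n) → XorImage s n x → XorImage (s ⊕ d) n x
xorImage-shift {s} {d} {n} closed (w , w<n , refl) = w ⊕ d , closed w w<n , shifted
  where
  open ≡-Reasoning
  shifted : (s ⊕ d) ⊕ (w ⊕ d) ≡ s ⊕ w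
  shifted = begin
    (s ⊕ d) ⊕ (w ⊕ d)   ≡⟨ ⊕-assoc s d (w ⊕ d) ⟩
    s ⊕ (d ⊕ (w ⊕ d))   ≡⟨ cong (λ t → s ⊕ (d ⊕ t)) (⊕-comm w d) ⟩
    s ⊕ (d ⊕ (d ⊕ w))   ≡⟨ cong (s ⊕_) (⊕-cancelˡ d w) ⟩
    s ⊕ w               ∎

xorImage-step : ∀ s n →
  (∀ x → x < suc s ⊕ n → x ⊕ n ≤ s ⊎ XorImage s n x) →
  ¬ XorImage s n (suc s ⊕ n) →
  ∀ x → XorImage s n x ⇔ XorImage (suc s) n x
xorImage-step s n covered avoided x = mk⇔
  (λ img → subst (λ t → XorImage t n x) (⊕-cancelˡ s (suc s)) (xorImage-shift {s} closed img))
  (λ img → subst (λ t → XorImage t n x) s′≡s (xorImage-shift {suc s} closed img))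
  where
  closed : ∀ w → w < n → w ⊕ (s ⊕ suc s) < n
  closed = ⊕-mask-closed s n
    (λ y y< → map₂ (Equivalence.to xorImage⇔) (covered y y<))
    (≮⇒≥ (λ lt → avoided (Equivalence.from xorImage⇔ lt)))
  s′≡s : suc s ⊕ (s ⊕ suc s) ≡ s
  s′≡s = trans (cong (suc s ⊕_) (⊕-comm s (suc s))) (⊕-cancelˡ (suc s) s)

range⊆⇒≤length : ∀ n (l : List ℕ) → (∀ x → x < n → x ∈ l) → n ≤ length l
range⊆⇒≤length zero    l range⊆ = z≤n
range⊆⇒≤length (suc n) l range⊆ with ∈-∃++ (range⊆ n ≤-refl)
... | ys , zs , refl = begin
  suc n                      ≤⟨ s≤s (range⊆⇒≤length n (ys ++ zs) range⊆′) ⟩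
  suc (length (ys ++ zs))    ≡⟨ cong suc (length-++ ys) ⟩
  suc (length ys + length zs) ≡⟨ +-suc (length ys) (length zs) ⟨
  length ys + length (n ∷ zs) ≡⟨ length-++ ys ⟨
  length (ys ++ n ∷ zs)      ∎
  where
  open ≤-Reasoning
  range⊆′ : ∀ x → x < n → x ∈ ys ++ zs
  range⊆′ x x<n with ∈-++⁻ ys (range⊆ x (m<n⇒m<1+n x<n))
  ... | inj₁ x∈ys          = ∈-++⁺ˡ x∈ys
  ... | inj₂ (here refl)   = contradiction x<n (<-irrefl refl)
  ... | inj₂ (there x∈zs) = ∈-++⁺ʳ ys x∈zs

range⊆-suc : ∀ {n l} → (∀ x → x < n → x ∈ l) → n ∈ l → ∀ x → x < suc n → x ∈ l
range⊆-suc range⊆ n∈l x x<1+n with m≤n⇒m<n∨m≡n (≤-pred x<1+n)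
... | inj₁ x<n  = range⊆ x x<n
... | inj₂ refl = n∈l

mexFrom-below : ∀ k n l → (∀ x → x < n → x ∈ l) → ∀ x → x < mexFrom k n l → x ∈ l
mexFrom-below zero    n l range⊆ = range⊆
mexFrom-below (suc k) n l range⊆ with n ∈? l
... | yes n∈l = mexFrom-below k (suc n) l (range⊆-suc range⊆ n∈l)
... | no  _   = range⊆

mexFrom-∉ : ∀ k n l → (∀ x → x < n → x ∈ l) → length l < n + k → mexFrom k n l ∉ l
mexFrom-∉ zero n l range⊆ short _ =
  <-irrefl refl (<-≤-trans (subst (length l <_) (+-identityʳ n) short) (range⊆⇒≤length n l range⊆))
mexFrom-∉ (suc k) n l range⊆ short with n ∈? l
... | yes n∈l = mexFrom-∉ k (suc n) l (range⊆-suc range⊆ n∈l) (subst (length l <_) (+-suc n k) short)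
... | no  n∉l = n∉l

mex-below : ∀ l x → x < mex l → x ∈ l
mex-below l = mexFrom-below (suc (length l)) 0 l (λ _ ())

mex-∉ : ∀ l → mex l ∉ l
mex-∉ l = mexFrom-∉ (suc (length l)) 0 l (λ _ ()) ≤-refl

∈-∷ʳ⁻ : ∀ {x a : ℕ} xs → x ∈ xs ++ [ a ] → x ∈ xs ⊎ x ≡ a
∈-∷ʳ⁻ xs x∈ with ∈-++⁻ xs x∈
... | inj₁ x∈xs        = inj₁ x∈xs
... | inj₂ (here x≡a) = inj₂ x≡a

zip-∷ʳ : ∀ {A B : Set} (xs : List A) (ys : List B) {a b} → length xs ≡ length ys →
         zip (xs ++ [ a ]) (ys ++ [ b ]) ≡ zip xs ys ++ [ (a , b) ]
zip-∷ʳ []       []       _  = refl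
zip-∷ʳ (x ∷ xs) (y ∷ ys) eq = cong ((x , y) ∷_) (zip-∷ʳ xs ys (suc-injective eq))

length-columns : ∀ f z → length (columns f z) ≡ z
length-columns f zero    = refl
length-columns f (suc z) = begin
  length (columns f z ++ _)   ≡⟨ length-++ (columns f z) ⟩
  length (columns f z) + 1    ≡⟨ +-comm (length (columns f z)) 1 ⟩
  suc (length (columns f z))  ≡⟨ cong suc (length-columns f z) ⟩
  suc z                       ∎
  where open ≡-Reasoning

optsW-columns-suc : ∀ f z y →
  optsW f (suc z) (columns f (suc z)) y ≡ optsW f z (columns f z) y ++ [ G f (y ⊓ f z) z ]
optsW-columns-suc f z y = begin
  map value (zip (upTo (suc z)) (columns f (suc z)))                  ≡⟨ cong (λ ws → map value (zip ws (columns f (suc z)))) (upTo-∷ʳ z) ⟨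
  map value (zip (upTo z ++ [ z ]) (columns f (suc z)))               ≡⟨ cong (map value) (zip-∷ʳ (upTo z) (columns f z)
                                                                          (trans (length-upTo z) (sym (length-columns f z)))) ⟩
  map value (zip (upTo z) (columns f z) ++ [ (z , column f z (columns f z)) ]) ≡⟨ map-++ value (zip (upTo z) (columns f z)) _ ⟩
  optsW f z (columns f z) y ++ [ G f (y ⊓ f z) z ]                    ∎
  where
  open ≡-Reasoning
  value : ℕ × (ℕ → ℕ) → ℕ
  value (w , g) = g (y ⊓ f w)

Options : (ℕ → ℕ) → ℕ → ℕ → ℕ → Set
Options f y z x = Σ ℕ λ w → w < z × G f (y ⊓ f w) w ≡ x

∈-optsW⁻ : ∀ f z y {x} → x ∈ optsW f z (columns f z) y → Options f y z x
∈-optsW⁻ f (suc z) y x∈ with ∈-∷ʳ⁻ (optsW f z (columns f z) y) (subst (_ ∈_) (optsW-columns-suc f z y) x∈)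
... | inj₁ x∈opts = let (w , w<z , eq) = ∈-optsW⁻ f z y x∈opts in w , m<n⇒m<1+n w<z , eq
... | inj₂ x≡     = z , ≤-refl , sym x≡

∈-optsW⁺ : ∀ f z y {x} → Options f y z x → x ∈ optsW f z (columns f z) y
∈-optsW⁺ f (suc z) y (w , w<1+z , refl) =
  subst (_ ∈_) (sym (optsW-columns-suc f z y)) (last-or-earlier (m≤n⇒m<n∨m≡n (≤-pred w<1+z)))
  where
  last-or-earlier : w < z ⊎ w ≡ z → G f (y ⊓ f w) w ∈ optsW f z (columns f z) y ++ [ G f (y ⊓ f z) z ]
  last-or-earlier (inj₁ w<z)  = ∈-++⁺ˡ (∈-optsW⁺ f z y (w , w<z , refl))
  last-or-earlier (inj₂ refl) = ∈-++⁺ʳ (optsW f z (columns f z) y) (here refl)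

∈-colVals⁻ : ∀ f z P y {x} → x ∈ colVals f z P y → Σ ℕ λ v → v < y × column f z P v ≡ x
∈-colVals⁻ f z P (suc y) x∈ with ∈-∷ʳ⁻ (colVals f z P y) x∈
... | inj₁ x∈vals = let (v , v<y , eq) = ∈-colVals⁻ f z P y x∈vals in v , m<n⇒m<1+n v<y , eq
... | inj₂ x≡     = y , ≤-refl , sym x≡

G-below : ∀ f y z {x} → x < G f y z → (Σ ℕ λ v → v < y × G f v z ≡ x) ⊎ Options f y z x
G-below f y z {x} x<G with ∈-++⁻ (colVals f z (columns f z) y) (mex-below _ x x<G)
... | inj₁ x∈vals = inj₁ (∈-colVals⁻ f z (columns f z) y x∈vals)
... | inj₂ x∈opts = inj₂ (∈-optsW⁻ f z y x∈opts)

G-∉-Options : ∀ f y z → ¬ Options f y z (G f y z)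
G-∉-Options f y z opt = mex-∉ (colVals f z (columns f z) y ++ optsW f z (columns f z) y)
  (∈-++⁺ʳ (colVals f z (columns f z) y) (∈-optsW⁺ f z y opt))

Σ<suc⇔ : ∀ {P : ℕ → Set} z → (Σ ℕ λ w → w < suc z × P w) ⇔ ((Σ ℕ λ w → w < z × P w) ⊎ P z)
Σ<suc⇔ {P} z = mk⇔ split join
  where
  split : (Σ ℕ λ w → w < suc z × P w) → (Σ ℕ λ w → w < z × P w) ⊎ P z
  split (w , w<1+z , p) with m≤n⇒m<n∨m≡n (≤-pred w<1+z)
  ... | inj₁ w<z  = inj₁ (w , w<z , p)
  ... | inj₂ refl = inj₂ p
  join : (Σ ℕ λ w → w < z × P w) ⊎ P z → Σ ℕ λ w → w < suc z × P w
  join (inj₁ (w , w<z , p)) = w , m<n⇒m<1+n w<z , p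
  join (inj₂ p)             = z , ≤-refl , p

module _ {f : ℕ → ℕ} (mono : Nondecreasing f) (nim : ∀ y z → y ≤ f z → G f y z ≡ y ⊕ z) where

  open import Relation.Binary.Reasoning.Setoid (⇔-setoid 0ℓ)

  options-saturated : ∀ {y y′ z x} → f z ≤ y → f z ≤ y′ → Options f y (suc z) x ⇔ Options f y′ (suc z) x
  options-saturated {z = z} {x = x} fz≤y fz≤y′ = mk⇔ (move fz≤y fz≤y′) (move fz≤y′ fz≤y)
    where
    move : ∀ {a b} → f z ≤ a → f z ≤ b → Options f a (suc z) x → Options f b (suc z) x
    move fz≤a fz≤b (w , w<1+z , eq) = w , w<1+z , trans (trans (at fz≤b) (sym (at fz≤a))) eq
      where
      at : ∀ {c} → f z ≤ c → G f (c ⊓ f w) w ≡ G f (f w) w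
      at fz≤c = cong (λ t → G f t w) (m≥n⇒m⊓n≡n (≤-trans (mono (≤-pred w<1+z)) fz≤c))

  extend-column : ∀ {y z} → y ≤ f z → (∀ x → Options f y z x ⇔ XorImage y z x) →
                  ∀ x → Options f y (suc z) x ⇔ XorImage y (suc z) x
  extend-column {y} {z} y≤fz earlier x = begin
    Options f y (suc z) x                      ≈⟨ Σ<suc⇔ z ⟩
    (Options f y z x ⊎ G f (y ⊓ f z) z ≡ x)    ≈⟨ earlier x ⊎-⇔ mk⇔ (trans (sym last≡)) (trans last≡) ⟩
    (XorImage y z x ⊎ y ⊕ z ≡ x)               ≈⟨ Σ<suc⇔ z ⟨
    XorImage y (suc z) x                       ∎
    where
    last≡ : G f (y ⊓ f z) z ≡ y ⊕ z
    last≡ = trans (cong (λ t → G f t z) (m≤n⇒m⊓n≡m y≤fz)) (nim y z y≤fz)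

  raise-height : ∀ {s z} → f z ≤ s → suc s ≤ f (suc z) → (∀ x → Options f s (suc z) x ⇔ XorImage s (suc z) x) →
                 ∀ x → Options f (suc s) (suc z) x ⇔ XorImage (suc s) (suc z) x
  raise-height {s} {z} fz≤s 1+s≤ lower x = begin
    Options f (suc s) (suc z) x   ≈⟨ saturated ⟩
    Options f s (suc z) x         ≈⟨ lower x ⟩
    XorImage s (suc z) x          ≈⟨ xorImage-step s (suc z) covered avoided x ⟩
    XorImage (suc s) (suc z) x    ∎
    where
    n : ℕ
    n = suc z
    saturated : ∀ {y} → Options f (suc s) n y ⇔ Options f s n y
    saturated = options-saturated (m≤n⇒m≤1+n fz≤s) fz≤s
    G≡ : G f (suc s) n ≡ suc s ⊕ n
    G≡ = nim (suc s) n 1+s≤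
    covered : ∀ y → y < suc s ⊕ n → y ⊕ n ≤ s ⊎ XorImage s n y
    covered y y< with G-below f (suc s) n (subst (y <_) (sym G≡) y<)
    ... | inj₁ (v , v<1+s , refl) = inj₁ (subst (_≤ s) (sym v≡) (≤-pred v<1+s))
      where
      v≡ : G f v n ⊕ n ≡ v
      v≡ = trans (cong (_⊕ n) (nim v n (≤-trans (<⇒≤ v<1+s) 1+s≤))) (⊕-cancelʳ v n)
    ... | inj₂ opt = inj₂ (Equivalence.to (lower y) (Equivalence.to saturated opt))
    avoided : ¬ XorImage s n (suc s ⊕ n)
    avoided img = G-∉-Options f (suc s) n
      (subst (Options f (suc s) n) (sym G≡) (Equivalence.from saturated (Equivalence.from (lower _) img)))

  options⇔xorImage : ∀ z y → y ≤ f z → ∀ x → Options f y z x ⇔ XorImage y z x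
  options⇔xorImage zero    y _ x = mk⇔ (λ { (_ , () , _) }) (λ { (_ , () , _) })
  options⇔xorImage (suc z) = heights
    where
    heights : ∀ y → y ≤ f (suc z) → ∀ x → Options f y (suc z) x ⇔ XorImage y (suc z) x
    heights y y≤ with y ≤? f z
    heights y       y≤ | yes y≤fz = extend-column y≤fz (options⇔xorImage z y y≤fz)
    heights zero    y≤ | no  y≰fz = contradiction z≤n y≰fz
    heights (suc s) y≤ | no  y≰fz = raise-height (≤-pred (≰⇒> y≰fz)) y≤ (heights s (<⇒≤ y≤))

mainTheorem13 : (f : ℕ → ℕ) → Nondecreasing f →
    (∀ y z → y ≤ f z → G f y z ≡ y ⊕ z) →
    ∀ y z → y ≤ f z →
      ∀ x → ((Σ ℕ λ w → w < z × G f (y ⊓ f w) w ≡ x) → (Σ ℕ λ w → w < z × y ⊕ w ≡ x))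
          × ((Σ ℕ λ w → w < z × y ⊕ w ≡ x) → (Σ ℕ λ w → w < z × G f (y ⊓ f w) w ≡ x))
mainTheorem13 f mono nim y z y≤fz x = Equivalence.to options≡ , Equivalence.from options≡
  where
  options≡ : Options f y z x ⇔ XorImage y z x
  options≡ = options⇔xorImage mono nim z y y≤fz x
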